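{- Let $U$ be a unital of order $n \ge 2$ and let $c(n) = n^2 - \frac{\sqrt{8n^2+9}-3}{2}$. Then either $m(U) > \lfloor c(n)\rfloor$ or \[ m(U) \le n^3+1 - \frac{n^2(n^2+1)}{2}\, i(G_U). \]
   Context: A unital of order $n\ge 2$ is a $2$-$(n^3+1,n+1,1)$ design $(P,\mathcal{B})$: $P$ is a set of $n^3+1$ points, $\mathcal{B}$ a set of $(n+1)$-subsets (lines) such that every two points lie on exactly one line. $G_U$ is the incidence graph: bipartite graph on $P\cup\mathcal{B}$ with $p\sim B$ iff $p\in B$. For a graph $G$ and $S\subseteq V(G)$, $N(S)$ is the set of vertices outside $S$ adjacent to some vertex of $S$, and $i(G)=\min\{|N(S)|/|S| : \emptyset\ne S\subseteq V(G),\ |S|\le |V(G)|/2\}$. A $k$-arc ($k\ge3$) is a set of $k$ points no three collinear; $m(U)$ is the maximum size of an arc in $U$. -}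

module Defs where

open import Data.Nat as ℕ using (ℕ; zero; suc; _^_)
open import Data.Integer as ℤ using (ℤ; +_; 0ℤ)
open import Data.Fin using (Fin; splitAt)
open import Data.Fin.Subset using (Subset; _∈_; ∣_∣; outside)
open import Data.Bool using (Bool; true; false; _∧_; _∨_; not)
open import Data.Vec using (Vec; lookup; tabulate; foldr)
open import Data.Sum using (_⊎_; inj₁; inj₂)
open import Data.Product using (Σ; ∃; ∃-syntax; _×_; _,_)
open import Relation.Binary.PropositionalEquality using (_≡_; _≢_)
open import Relation.Nullary using (¬_)
open import Data.Rational as ℚ using (ℚ)

-- Points are Fin (n³+1);
-- the lines are indexed by Fin b, line j being a subset of the points.
-- (Distinctness of lines follows from the pair axiom since n+1 ≥ 2.)
record Unital (n : ℕ) : Set where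
  field
    b         : ℕ
    line      : Fin b → Subset (n ^ 3 ℕ.+ 1)
    line-size : ∀ j → ∣ line j ∣ ≡ suc n
    two-points-one-line :
      ∀ (p q : Fin (n ^ 3 ℕ.+ 1)) → p ≢ q →
        Σ (Fin b) λ j → (p ∈ line j × q ∈ line j) ×
          (∀ j′ → p ∈ line j′ → q ∈ line j′ → j′ ≡ j)

module _ {n : ℕ} (U : Unital n) where
  open Unital U

  Point : Set
  Point = Fin (n ^ 3 ℕ.+ 1)

  Collinear : Point → Point → Point → Set
  Collinear p q r = ∃[ j ] (p ∈ line j × q ∈ line j × r ∈ line j)

  IsArc : Subset (n ^ 3 ℕ.+ 1) → Set
  IsArc A = (3 ℕ.≤ ∣ A ∣) ×
    (∀ p q r → p ∈ A → q ∈ A → r ∈ A → p ≢ q → q ≢ r → p ≢ r →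
       ¬ Collinear p q r)

  IsMaxArcSize : ℕ → Set
  IsMaxArcSize m = (∃[ A ] (IsArc A × ∣ A ∣ ≡ m)) ×
                   (∀ A → IsArc A → ∣ A ∣ ℕ.≤ m)

record Graph : Set where
  field
    N   : ℕ
    adj : Fin N → Fin N → Bool

module _ (G : Graph) where
  open Graph G

  nbhd : Subset N → Subset N
  nbhd S = tabulate λ x →
    not (lookup S x) ∧ foldr _ _∨_ false (tabulate λ y → lookup S y ∧ adj y x)

  -- Nonemptiness is
  -- expressed as |S| = suc k, so the quotient is |N(S)| / (suc k).
  IsIsoNumber : ℚ → Set
  IsIsoNumber q =
    (∃[ S ] ∃[ k ] (∣ S ∣ ≡ suc k × 2 ℕ.* suc k ℕ.≤ N ×
                    q ≡ (+ ∣ nbhd S ∣) ℚ./ suc k)) ×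
    (∀ S k → ∣ S ∣ ≡ suc k → 2 ℕ.* suc k ℕ.≤ N →
       q ℚ.≤ (+ ∣ nbhd S ∣) ℚ./ suc k)

-- The incidence graph G_U on vertex set P ⊎ B, encoded as Fin (v + b).
incidenceGraph : ∀ {n} → Unital n → Graph
incidenceGraph {n} U = record { N = n ^ 3 ℕ.+ 1 ℕ.+ b ; adj = a }
  where
  open Unital U
  a : Fin (n ^ 3 ℕ.+ 1 ℕ.+ b) → Fin (n ^ 3 ℕ.+ 1 ℕ.+ b) → Bool
  a x y with splitAt (n ^ 3 ℕ.+ 1) x | splitAt (n ^ 3 ℕ.+ 1) y
  ... | inj₁ p | inj₂ B = lookup (line B) p
  ... | inj₂ B | inj₁ p = lookup (line B) p
  ... | _      | _      = false

-- c(n) = n² − (√(8n²+9) − 3)/2, compared with integers without reals.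
-- With s = √(8n²+9):
--   x ≤ c(n)  ⟺  s ≤ 2n²+3−2x  ⟺  0 ≤ t ∧ 8n²+9 ≤ t²   (t = 2n²+3−2x)
--   c(n) < x  ⟺  2n²+3−2x < s  ⟺  t < 0 ∨ t² < 8n²+9

disc : ℕ → ℤ
disc n = + (8 ℕ.* n ^ 2 ℕ.+ 9)

tC : ℕ → ℤ → ℤ
tC n x = + (2 ℕ.* n ^ 2 ℕ.+ 3) ℤ.- (+ 2) ℤ.* x

_≤c[_] : ℤ → ℕ → Set
x ≤c[ n ] = (0ℤ ℤ.≤ tC n x) × (disc n ℤ.≤ tC n x ℤ.* tC n x)

c[_]<_ : ℕ → ℤ → Set
c[ n ]< x = (tC n x ℤ.< 0ℤ) ⊎ (tC n x ℤ.* tC n x ℤ.< disc n)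

IsFloorC : ℕ → ℤ → Set
IsFloorC n k = (k ≤c[ n ]) × (c[ n ]< (k ℤ.+ ℤ.+ 1))

module Submission where

-- Corollary 1.5.  Let U be a unital of order n and m = m(U).  If m ≤ ⌊c(n)⌋ then
-- m ≤ n³ + 1 − n²(n²+1)/2 · i(G_U).
--
-- Idea.  m ≤ c(n) means 2n²m + 3m ≤ n²(n²+1) + m².  Write t_j = |A ∩ ℓ_j| for the lines ℓ_j;
-- t_j ≤ 2 since A is an arc.  Double counting in the 2-(n³+1, n+1, 1) design (every point lies
-- on n² lines, and there are b = n²(n²−n+1) lines) gives Σ t_j = n²m and Σ t_j² = m² + (n²−1)m,
-- so the number M of lines meeting A satisfies 2M + m² = 2n²m + m.  For H = n²(n²+1)/2 this
-- yields M + m ≤ H ≤ b, so there is a set L of H − m lines containing every line that meets A.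
-- The vertex set S = A ∪ L of G_U has |S| = H ≤ |V(G_U)|/2 (because v + b = 2H + 1), and its
-- neighbourhood consists of points outside A only, so i(G_U) ≤ |N(S)|/|S| ≤ (v − m)/H.

open import Defs

open import Data.Bool using (Bool; true; false; _∧_; _∨_; not)
open import Data.Bool.Properties using (not-involutive)
open import Data.Nat using (ℕ; zero; suc; _+_; _*_; _∸_; _^_; _≤_; _≥_; z≤n; s≤s; _≤?_; NonZero)
open import Data.Nat.Properties
open import Data.Nat.Tactic.RingSolver using (solve-∀)
open import Data.Nat.Solver using (module +-*-Solver)
open import Data.Integer as ℤ using (ℤ; 0ℤ)
import Data.Integer.Properties as ℤ
import Data.Integer.Tactic.RingSolver as ℤ-Solver
open import Data.Rational as ℚ using (ℚ; toℚᵘ)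
open import Data.Rational.Properties
  using (toℚᵘ-cancel-≤; toℚᵘ-mono-≤; toℚᵘ-fromℚᵘ; toℚᵘ-homo-+; toℚᵘ-homo‿-; toℚᵘ-homo-*)
open import Data.Rational.Unnormalised as ℚᵘ using (ℚᵘ; mkℚᵘ; *≤*; *≡*)
import Data.Rational.Unnormalised.Properties as ℚᵘ
open import Data.Fin using (Fin; zero; suc; splitAt)
open import Data.Fin.Patterns using (0F; 1F; 2F)
open import Data.Fin.Properties using (punchInᵢ≢i) renaming (suc-injective to fsuc-injective)
open import Data.Fin.Subset using (Subset; inside; outside; ∣_∣; _∈_; _⊆_; _∩_; ∁; ⊥)
open import Data.Fin.Subset.Properties
  using (in⊆in; s⊆s; out⊆; ∣p∣≤n; p⊆q⇒∣p∣≤∣q∣; ∣⊥∣≡0; ∣∁p∣≡n∸∣p∣; x∈p∩q⁺; x∈p∩q⁻; x∈p⇒∣p-x∣<∣p∣)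
open import Data.Vec using ([]; _∷_; _++_; lookup; tabulate; foldr; here; there)
open import Data.Vec.Properties
  using ([]=⇒lookup; lookup⇒[]=; lookup-zipWith; lookup∘tabulate; lookup-map; lookup-splitAt)
open import Data.Vec.Functional using (removeAt)
open import Data.Product using (Σ; _×_; _,_; proj₁; proj₂)
open import Data.Sum using (_⊎_; inj₁; inj₂; [_,_]′; map₂)
open import Function using (_∘_)
open import Function.Definitions using (Injective)
open import Relation.Nullary using (¬_; yes; no; contradiction)
open import Relation.Nullary.Decidable using (toSum)
open import Relation.Binary.PropositionalEquality
open import Algebra.Properties.Semiring.Sum +-*-semiring
  using (sum; sum-syntax; sum-cong-≗; ∑-distrib-+; ∑-comm; *-distribˡ-sum; *-distribʳ-sum; sum-remove)

sum-const : ∀ k c → ∑[ i < k ] c ≡ k * c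
sum-const zero    c = refl
sum-const (suc k) c = cong (c +_) (sum-const k c)

sum-product : ∀ {k l} (f : Fin k → ℕ) (g : Fin l → ℕ) →
              sum f * sum g ≡ ∑[ i < k ] ∑[ j < l ] (f i * g j)
sum-product f g = trans (*-distribʳ-sum (sum g) f) (sum-cong-≗ λ i → *-distribˡ-sum (f i) g)

sum-agree-off : ∀ {k} (f g : Fin k → ℕ) (p : Fin k) → (∀ i → i ≢ p → f i ≡ g i) →
                sum f + g p ≡ sum g + f p
sum-agree-off {suc k} f g p agree = begin
  sum f + g p                            ≡⟨ cong (_+ g p) (sum-remove {i = p} f) ⟩
  f p + sum (removeAt f p) + g p         ≡⟨ cong (λ s → f p + s + g p) rest ⟩
  f p + sum (removeAt g p) + g p         ≡⟨ swap-ends (f p) _ (g p) ⟩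
  g p + sum (removeAt g p) + f p         ≡⟨ cong (_+ f p) (sum-remove {i = p} g) ⟨
  sum g + f p                            ∎
  where
  open ≡-Reasoning
  swap-ends : ∀ a r c → a + r + c ≡ c + r + a
  swap-ends = solve-∀
  rest : sum (removeAt f p) ≡ sum (removeAt g p)
  rest = sum-cong-≗ (λ i → agree _ (punchInᵢ≢i p i))

⟦_⟧ : Bool → ℕ
⟦ true  ⟧ = 1
⟦ false ⟧ = 0

⟦∧⟧ : ∀ x y → ⟦ x ∧ y ⟧ ≡ ⟦ x ⟧ * ⟦ y ⟧
⟦∧⟧ true  y = sym (+-identityʳ ⟦ y ⟧)
⟦∧⟧ false y = refl

⟦⟧-idem : ∀ x → ⟦ x ⟧ * ⟦ x ⟧ ≡ ⟦ x ⟧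
⟦⟧-idem true  = refl
⟦⟧-idem false = refl

size-as-sum : ∀ {k} (p : Subset k) → ∣ p ∣ ≡ ∑[ i < k ] ⟦ lookup p i ⟧
size-as-sum []            = refl
size-as-sum (inside ∷ p)  = cong suc (size-as-sum p)
size-as-sum (outside ∷ p) = size-as-sum p

size-++ : ∀ {k l} (p : Subset k) (q : Subset l) → ∣ p ++ q ∣ ≡ ∣ p ∣ + ∣ q ∣
size-++ []            q = refl
size-++ (inside ∷ p)  q = cong suc (size-++ p q)
size-++ (outside ∷ p) q = size-++ p q

members : ∀ {n} (p : Subset n) {k} → k ≤ ∣ p ∣ →
          Σ (Fin k → Fin n) λ f → Injective _≡_ _≡_ f × (∀ i → f i ∈ p)
members p {zero} _ = (λ ()) , (λ {}) , (λ ())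
members (inside ∷ p) {suc k} (s≤s k≤∣p∣) with members p k≤∣p∣
... | f , f-inj , f∈p = g , g-inj , g∈p
  where
  g : Fin (suc k) → Fin _
  g zero    = zero
  g (suc i) = suc (f i)
  g-inj : Injective _≡_ _≡_ g
  g-inj {zero}  {zero}  _  = refl
  g-inj {suc i} {suc j} eq = cong suc (f-inj (fsuc-injective eq))
  g∈p : ∀ i → g i ∈ inside ∷ p
  g∈p zero    = here
  g∈p (suc i) = there (f∈p i)
members (outside ∷ p) {suc k} k≤∣p∣ with members p k≤∣p∣
... | f , f-inj , f∈p = suc ∘ f , (λ eq → f-inj (fsuc-injective eq)) , there ∘ f∈p

extend-to-size : ∀ {k} (X : Subset k) c → ∣ X ∣ ≤ c → c ≤ k → Σ (Subset k) λ L → X ⊆ L × ∣ L ∣ ≡ c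
extend-to-size []            zero    _            _           = [] , (λ ()) , refl
extend-to-size (inside ∷ X)  (suc c) (s≤s ∣X∣≤c) (s≤s c≤k) with extend-to-size X c ∣X∣≤c c≤k
... | L , X⊆L , ∣L∣≡c = inside ∷ L , in⊆in X⊆L , cong suc ∣L∣≡c
extend-to-size {suc k} (outside ∷ X) c ∣X∣≤c _ with c ≤? k
... | yes c≤k with extend-to-size X c ∣X∣≤c c≤k
...   | L , X⊆L , ∣L∣≡c = outside ∷ L , s⊆s X⊆L , ∣L∣≡c
extend-to-size {suc k} (outside ∷ X) zero    _      _         | no 0≰k = contradiction z≤n 0≰k
extend-to-size {suc k} (outside ∷ X) (suc c) ∣X∣≤c (s≤s c≤k) | no c≰k
  with extend-to-size X c (≤-trans (∣p∣≤n X) (≮⇒≥ c≰k)) c≤k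
...   | L , X⊆L , ∣L∣≡c = inside ∷ L , out⊆ X⊆L , cong suc ∣L∣≡c

flags-cancel : ∀ x n c → x * (1 + n) + 1 ≡ c + 1 + x → n * x ≡ c
flags-cancel x n c eq = +-cancelʳ-≡ (1 + x) (n * x) c (begin
  n * x + (1 + x)    ≡⟨ regroup x n ⟩
  x * (1 + n) + 1    ≡⟨ eq ⟩
  c + 1 + x          ≡⟨ +-assoc c 1 x ⟩
  c + (1 + x)        ∎)
  where
  open ≡-Reasoning
  regroup : ∀ x n → n * x + (1 + x) ≡ x * (1 + n) + 1
  regroup = solve-∀

module Counting {n : ℕ} (U : Unital n) where
  open Unital U

  v : ℕ
  v = n ^ 3 + 1

  I : Fin b → Fin v → ℕ
  I j p = ⟦ lookup (line j) p ⟧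

  r : Fin v → ℕ
  r p = ∑[ j < b ] I j p

  through : Fin v → Fin v → ℕ
  through p q = ∑[ j < b ] (I j p * I j q)

  points-on-line : ∀ j → ∑[ p < v ] I j p ≡ suc n
  points-on-line j = trans (sym (size-as-sum (line j))) (line-size j)

  through-self : ∀ p → through p p ≡ r p
  through-self p = sum-cong-≗ (λ j → ⟦⟧-idem (lookup (line j) p))

  through-distinct : ∀ p q → p ≢ q → through p q ≡ 1
  through-distinct p q p≢q with two-points-one-line p q p≢q
  ... | j₀ , (p∈j₀ , q∈j₀) , unique = begin
    through p q                      ≡⟨ +-identityʳ _ ⟨
    through p q + 0                  ≡⟨ sum-agree-off _ (λ _ → 0) j₀ off-j₀ ⟩
    ∑[ j < b ] 0 + I j₀ p * I j₀ q   ≡⟨ cong₂ _+_ (trans (sum-const b 0) (*-zeroʳ b))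
                                              (cong₂ (λ x y → ⟦ x ⟧ * ⟦ y ⟧) ([]=⇒lookup p∈j₀) ([]=⇒lookup q∈j₀)) ⟩
    1                                ∎
    where
    open ≡-Reasoning
    off-j₀ : ∀ j → j ≢ j₀ → I j p * I j q ≡ 0
    off-j₀ j j≢j₀ with lookup (line j) p in p∈j | lookup (line j) q in q∈j
    ... | false | _     = refl
    ... | true  | false = refl
    ... | true  | true  = contradiction (unique j (lookup⇒[]= p (line j) p∈j) (lookup⇒[]= q (line j) q∈j)) j≢j₀

  -- Counting pairs (line through p, point on it) in two ways: r_p(n + 1) = (v − 1) + r_p.
  flag-count : ∀ p → r p * suc n + 1 ≡ v + r p
  flag-count p = begin
    r p * suc n + 1                                  ≡⟨ cong (_+ 1) (*-distribʳ-sum (suc n) (λ j → I j p)) ⟩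
    ∑[ j < b ] (I j p * suc n) + 1                   ≡⟨ cong (_+ 1) (sum-cong-≗ λ j → cong (I j p *_) (sym (points-on-line j))) ⟩
    ∑[ j < b ] (I j p * ∑[ q < v ] I j q) + 1        ≡⟨ cong (_+ 1) (sum-cong-≗ λ j → *-distribˡ-sum (I j p) (λ q → I j q)) ⟩
    ∑[ j < b ] ∑[ q < v ] (I j p * I j q) + 1        ≡⟨ cong (_+ 1) (∑-comm (λ j q → I j p * I j q)) ⟩
    ∑[ q < v ] through p q + 1                       ≡⟨ sum-agree-off (through p) (λ _ → 1) p
                                                          (λ q q≢p → through-distinct p q (q≢p ∘ sym)) ⟩
    ∑[ q < v ] 1 + through p p                       ≡⟨ cong₂ _+_ (trans (sum-const v 1) (*-identityʳ v)) (through-self p) ⟩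
    v + r p                                          ∎
    where open ≡-Reasoning

  replication : ⦃ _ : NonZero n ⦄ → ∀ p → r p ≡ n ^ 2
  replication p = *-cancelˡ-≡ (r p) (n ^ 2) n (flags-cancel (r p) n (n ^ 3) (flag-count p))

  line-count : ⦃ _ : NonZero n ⦄ → b * suc n ≡ v * n ^ 2
  line-count = begin
    b * suc n                    ≡⟨ sum-const b (suc n) ⟨
    ∑[ j < b ] (suc n)           ≡⟨ sum-cong-≗ (λ j → sym (points-on-line j)) ⟩
    ∑[ j < b ] ∑[ p < v ] I j p  ≡⟨ ∑-comm I ⟩
    ∑[ p < v ] r p               ≡⟨ sum-cong-≗ replication ⟩
    ∑[ p < v ] (n ^ 2)           ≡⟨ sum-const v (n ^ 2) ⟩
    v * n ^ 2                    ∎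
    where open ≡-Reasoning

-- A line meets an arc in t ≤ 2 points; 2·[t > 0] + t² = 3t is the identity behind counting
-- the lines that meet the arc.
positive : ℕ → Bool
positive zero    = false
positive (suc _) = true

tangents-and-secants : ∀ t → t ≤ 2 → 2 * ⟦ positive t ⟧ + t * t ≡ 3 * t
tangents-and-secants 0 _ = refl
tangents-and-secants 1 _ = refl
tangents-and-secants 2 _ = refl
tangents-and-secants (suc (suc (suc _))) (s≤s (s≤s ()))

interchange : ∀ a b c d → a * b * (c * d) ≡ a * c * (b * d)
interchange = solve-∀

peel : ∀ x y → 3 * x + y ≡ 2 * x + y + x
peel = solve-∀

module Arc {n : ℕ} ⦃ _ : NonZero n ⦄ (U : Unital n) (A : Subset (n ^ 3 + 1)) (arc : IsArc U A) where
  open Unital U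
  open Counting U

  m : ℕ
  m = ∣ A ∣

  a : Fin v → ℕ
  a p = ⟦ lookup A p ⟧

  t : Fin b → ℕ
  t j = ∣ A ∩ line j ∣

  m-as-sum : m ≡ ∑[ p < v ] a p
  m-as-sum = size-as-sum A

  t-as-sum : ∀ j → t j ≡ ∑[ p < v ] (a p * I j p)
  t-as-sum j = trans (size-as-sum (A ∩ line j))
    (sum-cong-≗ λ p → trans (cong ⟦_⟧ (lookup-zipWith _∧_ p A (line j))) (⟦∧⟧ (lookup A p) (lookup (line j) p)))

  -- Each point of A lies on n² lines.
  sum-t : ∑[ j < b ] t j ≡ n ^ 2 * m
  sum-t = begin
    ∑[ j < b ] t j                       ≡⟨ sum-cong-≗ t-as-sum ⟩
    ∑[ j < b ] ∑[ p < v ] (a p * I j p)  ≡⟨ ∑-comm (λ j p → a p * I j p) ⟩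
    ∑[ p < v ] ∑[ j < b ] (a p * I j p)  ≡⟨ sum-cong-≗ (λ p → *-distribˡ-sum (a p) (λ j → I j p)) ⟨
    ∑[ p < v ] (a p * r p)               ≡⟨ sum-cong-≗ (λ p → trans (cong (a p *_) (replication p)) (*-comm (a p) (n ^ 2))) ⟩
    ∑[ p < v ] (n ^ 2 * a p)             ≡⟨ *-distribˡ-sum (n ^ 2) a ⟨
    n ^ 2 * ∑[ p < v ] a p               ≡⟨ cong (n ^ 2 *_) m-as-sum ⟨
    n ^ 2 * m                            ∎
    where open ≡-Reasoning

  -- Σ_j t_j² counts ordered pairs of points of A together with a line through both.
  square-t : ∀ j → t j * t j ≡ ∑[ p < v ] ∑[ q < v ] (a p * a q * (I j p * I j q))
  square-t j = begin
    t j * t j                                              ≡⟨ cong₂ _*_ (t-as-sum j) (t-as-sum j) ⟩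
    ∑[ p < v ] (a p * I j p) * ∑[ q < v ] (a q * I j q)    ≡⟨ sum-product (λ p → a p * I j p) (λ q → a q * I j q) ⟩
    ∑[ p < v ] ∑[ q < v ] (a p * I j p * (a q * I j q))    ≡⟨ sum-cong-≗ (λ p → sum-cong-≗ λ q →
                                                                interchange (a p) (I j p) (a q) (I j q)) ⟩
    ∑[ p < v ] ∑[ q < v ] (a p * a q * (I j p * I j q))    ∎
    where open ≡-Reasoning

  sum-square-t : ∑[ j < b ] (t j * t j) ≡ ∑[ p < v ] ∑[ q < v ] (a p * a q * through p q)
  sum-square-t = begin
    ∑[ j < b ] (t j * t j)                                           ≡⟨ sum-cong-≗ square-t ⟩
    ∑[ j < b ] ∑[ p < v ] ∑[ q < v ] (a p * a q * (I j p * I j q))   ≡⟨ ∑-comm (λ j p → ∑[ q < v ] (a p * a q * (I j p * I j q))) ⟩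
    ∑[ p < v ] ∑[ j < b ] ∑[ q < v ] (a p * a q * (I j p * I j q))   ≡⟨ sum-cong-≗ (λ p → ∑-comm (λ j q → a p * a q * (I j p * I j q))) ⟩
    ∑[ p < v ] ∑[ q < v ] ∑[ j < b ] (a p * a q * (I j p * I j q))   ≡⟨ sum-cong-≗ (λ p → sum-cong-≗ λ q →
                                                                          *-distribˡ-sum (a p * a q) (λ j → I j p * I j q)) ⟨
    ∑[ p < v ] ∑[ q < v ] (a p * a q * through p q)                  ∎
    where open ≡-Reasoning

  -- The pairs with first point p ∈ A: one line for each q ≠ p in A, and n² lines when q = p.
  arc-row : ∀ p → ∑[ q < v ] (a p * a q * through p q) + a p ≡ a p * m + a p * n ^ 2
  arc-row p = begin
    row + a p                                        ≡⟨ cong (row +_) diagonal-weight ⟨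
    row + a p * a p * 1                              ≡⟨ sum-agree-off (λ q → a p * a q * through p q) (λ q → a p * a q * 1) p
                                                          (λ q q≢p → cong (a p * a q *_) (through-distinct p q (q≢p ∘ sym))) ⟩
    ∑[ q < v ] (a p * a q * 1) + a p * a p * through p p
                                                     ≡⟨ cong₂ _+_ off-diagonal diagonal ⟩
    a p * m + a p * n ^ 2                            ∎
    where
    open ≡-Reasoning
    row : ℕ
    row = ∑[ q < v ] (a p * a q * through p q)
    diagonal-weight : a p * a p * 1 ≡ a p
    diagonal-weight = trans (*-identityʳ (a p * a p)) (⟦⟧-idem (lookup A p))
    off-diagonal : ∑[ q < v ] (a p * a q * 1) ≡ a p * m
    off-diagonal = begin
      ∑[ q < v ] (a p * a q * 1)   ≡⟨ sum-cong-≗ (λ q → *-identityʳ (a p * a q)) ⟩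
      ∑[ q < v ] (a p * a q)       ≡⟨ *-distribˡ-sum (a p) a ⟨
      a p * ∑[ q < v ] a q         ≡⟨ cong (a p *_) m-as-sum ⟨
      a p * m                      ∎
    diagonal : a p * a p * through p p ≡ a p * n ^ 2
    diagonal = cong₂ _*_ (⟦⟧-idem (lookup A p)) (trans (through-self p) (replication p))

  sum-square-t-eq : ∑[ j < b ] (t j * t j) + m ≡ m * m + n ^ 2 * m
  sum-square-t-eq = begin
    ∑[ j < b ] (t j * t j) + m                                    ≡⟨ cong₂ _+_ sum-square-t m-as-sum ⟩
    ∑[ p < v ] ∑[ q < v ] (a p * a q * through p q) + ∑[ p < v ] a p
                                                                  ≡⟨ ∑-distrib-+ (λ p → ∑[ q < v ] (a p * a q * through p q)) a ⟨
    ∑[ p < v ] (∑[ q < v ] (a p * a q * through p q) + a p)       ≡⟨ sum-cong-≗ arc-row ⟩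
    ∑[ p < v ] (a p * m + a p * n ^ 2)                            ≡⟨ ∑-distrib-+ (λ p → a p * m) (λ p → a p * n ^ 2) ⟩
    ∑[ p < v ] (a p * m) + ∑[ p < v ] (a p * n ^ 2)               ≡⟨ cong₂ _+_ (*-distribʳ-sum m a) (*-distribʳ-sum (n ^ 2) a) ⟨
    ∑[ p < v ] a p * m + ∑[ p < v ] a p * n ^ 2                   ≡⟨ cong₂ _+_ (cong (_* m) m-as-sum)
                                                                               (cong (_* n ^ 2) m-as-sum) ⟨
    m * m + m * n ^ 2                                             ≡⟨ cong (m * m +_) (*-comm m (n ^ 2)) ⟩
    m * m + n ^ 2 * m                                             ∎
    where open ≡-Reasoning

  t≤2 : ∀ j → t j ≤ 2
  t≤2 j = ≮⇒≥ three-on-line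
    where
    three-on-line : ¬ 3 ≤ t j
    three-on-line 3≤t with members (A ∩ line j) 3≤t
    ... | f , f-inj , f∈ = proj₂ arc (f 0F) (f 1F) (f 2F) (in-A 0F) (in-A 1F) (in-A 2F)
                             (distinct λ ()) (distinct λ ()) (distinct λ ()) (j , on-j 0F , on-j 1F , on-j 2F)
      where
      in-A : ∀ i → f i ∈ A
      in-A i = proj₁ (x∈p∩q⁻ A (line j) (f∈ i))
      on-j : ∀ i → f i ∈ line j
      on-j i = proj₂ (x∈p∩q⁻ A (line j) (f∈ i))
      distinct : ∀ {i i′} → i ≢ i′ → f i ≢ f i′
      distinct i≢i′ = i≢i′ ∘ f-inj

  Meets : Subset b
  Meets = tabulate (positive ∘ t)

  ∈-Meets : ∀ {p j} → p ∈ A → p ∈ line j → j ∈ Meets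
  ∈-Meets {p} {j} p∈A p∈j = lookup⇒[]= j Meets (trans (lookup∘tabulate (positive ∘ t) j) (positive-at-least-one 1≤t))
    where
    1≤t : 1 ≤ t j
    1≤t = ≤-trans (s≤s z≤n) (x∈p⇒∣p-x∣<∣p∣ (x∈p∩q⁺ (p∈A , p∈j)))
    positive-at-least-one : ∀ {x} → 1 ≤ x → positive x ≡ true
    positive-at-least-one (s≤s _) = refl

  tangent-count : 2 * ∣ Meets ∣ + ∑[ j < b ] (t j * t j) ≡ 3 * (n ^ 2 * m)
  tangent-count = begin
    2 * ∣ Meets ∣ + ∑[ j < b ] (t j * t j)                        ≡⟨ cong (λ x → 2 * x + ∑[ j < b ] (t j * t j)) (size-as-sum Meets) ⟩
    2 * ∑[ j < b ] ⟦ lookup Meets j ⟧ + ∑[ j < b ] (t j * t j)     ≡⟨ cong (λ x → 2 * x + ∑[ j < b ] (t j * t j))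
                                                                         (sum-cong-≗ λ j → cong ⟦_⟧ (lookup∘tabulate (positive ∘ t) j)) ⟩
    2 * ∑[ j < b ] ⟦ positive (t j) ⟧ + ∑[ j < b ] (t j * t j)     ≡⟨ cong (_+ ∑[ j < b ] (t j * t j)) (*-distribˡ-sum 2 (λ j → ⟦ positive (t j) ⟧)) ⟩
    ∑[ j < b ] (2 * ⟦ positive (t j) ⟧) + ∑[ j < b ] (t j * t j)   ≡⟨ ∑-distrib-+ (λ j → 2 * ⟦ positive (t j) ⟧) (λ j → t j * t j) ⟨
    ∑[ j < b ] (2 * ⟦ positive (t j) ⟧ + t j * t j)                ≡⟨ sum-cong-≗ (λ j → tangents-and-secants (t j) (t≤2 j)) ⟩
    ∑[ j < b ] (3 * t j)                                           ≡⟨ *-distribˡ-sum 3 t ⟨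
    3 * ∑[ j < b ] t j                                             ≡⟨ cong (3 *_) sum-t ⟩
    3 * (n ^ 2 * m)                                                ∎
    where open ≡-Reasoning

  meets-count : 2 * ∣ Meets ∣ + m * m ≡ 2 * (n ^ 2 * m) + m
  meets-count = +-cancelʳ-≡ (n ^ 2 * m) _ _ (begin
    2 * ∣ Meets ∣ + m * m + n ^ 2 * m                        ≡⟨ +-assoc (2 * ∣ Meets ∣) (m * m) (n ^ 2 * m) ⟩
    2 * ∣ Meets ∣ + (m * m + n ^ 2 * m)                      ≡⟨ cong (2 * ∣ Meets ∣ +_) sum-square-t-eq ⟨
    2 * ∣ Meets ∣ + (∑[ j < b ] (t j * t j) + m)             ≡⟨ +-assoc (2 * ∣ Meets ∣) _ m ⟨
    2 * ∣ Meets ∣ + ∑[ j < b ] (t j * t j) + m               ≡⟨ cong (_+ m) tangent-count ⟩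
    3 * (n ^ 2 * m) + m                                      ≡⟨ peel (n ^ 2 * m) m ⟩
    2 * (n ^ 2 * m) + m + n ^ 2 * m                          ∎)
    where open ≡-Reasoning

∧-true : ∀ {x y} → x ∧ y ≡ true → x ≡ true × y ≡ true
∧-true {true} y≡true = refl , y≡true

any-true : ∀ {k} (g : Fin k → Bool) → foldr _ _∨_ false (tabulate g) ≡ true → Σ (Fin k) λ y → g y ≡ true
any-true {suc k} g any≡true with g zero in g₀
... | true  = zero , g₀
... | false with any-true (g ∘ suc) any≡true
...   | y , gy = suc y , gy

module IncidenceGraph {n : ℕ} (U : Unital n) where
  open Unital U
  open Graph (incidenceGraph U) using (adj)
  open Counting U using (v)

  adjacent-to-line : ∀ y x j → splitAt v x ≡ inj₂ j → adj y x ≡ true →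
                     Σ (Fin v) λ p → splitAt v y ≡ inj₁ p × lookup (line j) p ≡ true
  adjacent-to-line y x j x-is-j y~x with splitAt v y | splitAt v x
  adjacent-to-line y x j refl y~x | inj₁ p | .(inj₂ j) = p , refl , y~x
  adjacent-to-line y x j refl ()  | inj₂ _ | .(inj₂ j)

  nbhd-⊆ : (A : Subset v) (L : Subset b) → (∀ {p j} → p ∈ A → p ∈ line j → j ∈ L) →
           nbhd (incidenceGraph U) (A ++ L) ⊆ ∁ A ++ ⊥
  nbhd-⊆ A L closed {x} x∈N =
    lookup⇒[]= x (∁ A ++ ⊥) (trans (lookup-splitAt v (∁ A) ⊥ x) (outside-A (splitAt v x) refl))
    where
    S : Subset (v + b)
    S = A ++ L
    S-at-point : ∀ {z p} → splitAt v z ≡ inj₁ p → lookup S z ≡ lookup A p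
    S-at-point {z} z-is-p = trans (lookup-splitAt v A L z) (cong [ lookup A , lookup L ]′ z-is-p)
    S-at-line : ∀ {z j} → splitAt v z ≡ inj₂ j → lookup S z ≡ lookup L j
    S-at-line {z} z-is-j = trans (lookup-splitAt v A L z) (cong [ lookup A , lookup L ]′ z-is-j)
    x-new : not (lookup S x) ∧ foldr _ _∨_ false (tabulate λ y → lookup S y ∧ adj y x) ≡ true
    x-new = trans (sym (lookup∘tabulate _ x)) ([]=⇒lookup x∈N)
    x∉S : lookup S x ≡ false
    x∉S = trans (sym (not-involutive (lookup S x))) (cong not (proj₁ (∧-true x-new)))
    outside-A : ∀ s → splitAt v x ≡ s → [ lookup (∁ A) , lookup ⊥ ]′ s ≡ true
    outside-A (inj₁ p) x-is-p = trans (lookup-map p not A) (cong not (trans (sym (S-at-point x-is-p)) x∉S))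
    outside-A (inj₂ j) x-is-j with any-true _ (proj₂ (∧-true x-new))
    ... | y , y∈S∧y~x with ∧-true y∈S∧y~x
    ...   | y∈S , y~x with adjacent-to-line y x j x-is-j y~x
    ...     | p , y-is-p , p∈j = contradiction (trans (sym j∈L) (trans (sym (S-at-line x-is-j)) x∉S)) λ ()
      where
      p∈A : lookup A p ≡ true
      p∈A = trans (sym (S-at-point y-is-p)) y∈S
      j∈L : lookup L j ≡ true
      j∈L = []=⇒lookup (closed (lookup⇒[]= p A p∈A) (lookup⇒[]= p (line j) p∈j))

  nbhd-size : (A : Subset v) (L : Subset b) → (∀ {p j} → p ∈ A → p ∈ line j → j ∈ L) →
              ∣ nbhd (incidenceGraph U) (A ++ L) ∣ + ∣ A ∣ ≤ v
  nbhd-size A L closed = begin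
    ∣ nbhd (incidenceGraph U) (A ++ L) ∣ + ∣ A ∣   ≤⟨ +-monoˡ-≤ ∣ A ∣ (p⊆q⇒∣p∣≤∣q∣ (nbhd-⊆ A L closed)) ⟩
    ∣ ∁ A ++ ⊥ ∣ + ∣ A ∣                          ≡⟨ cong (_+ ∣ A ∣) (size-++ (∁ A) ⊥) ⟩
    ∣ ∁ A ∣ + ∣ ⊥ {n = b} ∣ + ∣ A ∣               ≡⟨ cong (λ k → ∣ ∁ A ∣ + k + ∣ A ∣) (∣⊥∣≡0 b) ⟩
    ∣ ∁ A ∣ + 0 + ∣ A ∣                           ≡⟨ cong (λ k → k + 0 + ∣ A ∣) (∣∁p∣≡n∸∣p∣ A) ⟩
    v ∸ ∣ A ∣ + 0 + ∣ A ∣                         ≡⟨ cong (_+ ∣ A ∣) (+-identityʳ (v ∸ ∣ A ∣)) ⟩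
    v ∸ ∣ A ∣ + ∣ A ∣                             ≡⟨ m∸n+n≡m (∣p∣≤n A) ⟩
    v                                            ∎
    where open ≤-Reasoning

-- ⌊c(n)⌋ is given through t(x) = 2n² + 3 − 2x: x ≤ c(n) iff t(x) ≥ 0 and t(x)² ≥ 8n² + 9.  An
-- integer m ≤ ⌊c(n)⌋ therefore satisfies t(m)² ≥ 8n² + 9, i.e. 2n²m + 3m ≤ n²(n² + 1) + m².
module FloorOfC where
  open import Data.Integer using (+_)

  discriminant : ∀ Q Y →
    let T = + 2 ℤ.* Q ℤ.+ + 3 ℤ.- + 2 ℤ.* Y in
    T ℤ.* T ℤ.- (+ 8 ℤ.* Q ℤ.+ + 9) ≡ + 4 ℤ.* ((Q ℤ.* (Q ℤ.+ + 1) ℤ.+ Y ℤ.* Y) ℤ.- (+ 2 ℤ.* Q ℤ.* Y ℤ.+ + 3 ℤ.* Y))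
  discriminant = ℤ-Solver.solve-∀

  below-root : ∀ Q Y → let T = + 2 ℤ.* Q ℤ.+ + 3 ℤ.- + 2 ℤ.* Y in
               + 8 ℤ.* Q ℤ.+ + 9 ℤ.≤ T ℤ.* T →
               + 2 ℤ.* Q ℤ.* Y ℤ.+ + 3 ℤ.* Y ℤ.≤ Q ℤ.* (Q ℤ.+ + 1) ℤ.+ Y ℤ.* Y
  below-root Q Y D≤T² =
    ℤ.0≤i-j⇒j≤i (ℤ.*-cancelˡ-≤-pos 0ℤ _ (+ 4) (subst (0ℤ ℤ.≤_) (discriminant Q Y) (ℤ.i≤j⇒0≤j-i D≤T²)))

  square-mono : ∀ {x y} → 0ℤ ℤ.≤ x → x ℤ.≤ y → x ℤ.* x ℤ.≤ y ℤ.* y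
  square-mono {x} {y} 0≤x x≤y = ℤ.≤-trans
    (ℤ.*-monoˡ-≤-nonNeg x ⦃ ℤ.nonNegative 0≤x ⦄ x≤y)
    (ℤ.*-monoʳ-≤-nonNeg y ⦃ ℤ.nonNegative (ℤ.≤-trans 0≤x x≤y) ⦄ x≤y)

  -- If m ≤ ⌊c(n)⌋ then t(m) ≥ t(⌊c(n)⌋) ≥ 0, so t(m)² ≥ 8n² + 9.
  floor-condition : ∀ n m (fc : ℤ) → IsFloorC n fc → + m ℤ.≤ fc →
                    2 * n ^ 2 * m + 3 * m ≤ n ^ 2 * (n ^ 2 + 1) + m * m
  floor-condition n m fc ((0≤t[fc] , D≤t[fc]²) , _) m≤fc =
    ℤ.drop‿+≤+ (subst₂ ℤ._≤_ (sym lhs-cast) (sym rhs-cast) (below-root (+ q) (+ m) D≤t[m]²))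
    where
    q : ℕ
    q = n ^ 2
    t[fc]≤t[m] : tC n fc ℤ.≤ tC n (+ m)
    t[fc]≤t[m] = ℤ.+-monoʳ-≤ (+ (2 * q + 3)) (ℤ.neg-mono-≤ (ℤ.*-monoˡ-≤-nonNeg (+ 2) m≤fc))
    disc-cast : disc n ≡ + 8 ℤ.* + q ℤ.+ + 9
    disc-cast = trans (ℤ.pos-+ (8 * q) 9) (cong (ℤ._+ + 9) (ℤ.pos-* 8 q))
    t-cast : tC n (+ m) ≡ + 2 ℤ.* + q ℤ.+ + 3 ℤ.- + 2 ℤ.* + m
    t-cast = cong (ℤ._- + 2 ℤ.* + m) (trans (ℤ.pos-+ (2 * q) 3) (cong (ℤ._+ + 3) (ℤ.pos-* 2 q)))
    D≤t[m]² : + 8 ℤ.* + q ℤ.+ + 9 ℤ.≤ (+ 2 ℤ.* + q ℤ.+ + 3 ℤ.- + 2 ℤ.* + m) ℤ.* (+ 2 ℤ.* + q ℤ.+ + 3 ℤ.- + 2 ℤ.* + m)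
    D≤t[m]² = subst₂ (λ d s → d ℤ.≤ s ℤ.* s) disc-cast t-cast
                (ℤ.≤-trans D≤t[fc]² (square-mono 0≤t[fc] t[fc]≤t[m]))
    lhs-cast : + (2 * q * m + 3 * m) ≡ + 2 ℤ.* + q ℤ.* + m ℤ.+ + 3 ℤ.* + m
    lhs-cast = trans (ℤ.pos-+ (2 * q * m) (3 * m))
                 (cong₂ ℤ._+_ (trans (ℤ.pos-* (2 * q) m) (cong (ℤ._* + m) (ℤ.pos-* 2 q))) (ℤ.pos-* 3 m))
    rhs-cast : + (q * (q + 1) + m * m) ≡ + q ℤ.* (+ q ℤ.+ + 1) ℤ.+ + m ℤ.* + m
    rhs-cast = trans (ℤ.pos-+ (q * (q + 1)) (m * m))
                 (cong₂ ℤ._+_ (trans (ℤ.pos-* q (q + 1)) (cong (+ q ℤ.*_) (ℤ.pos-+ q 1))) (ℤ.pos-* m m))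

-- The final rearrangement in ℚ: from i ≤ N/H and N + m ≤ v follows m ≤ v − H·i, with the factor
-- H written as 2H/2 as in the theorem.  The computation is done in unnormalised rationals.
module RatioBound where
  open import Data.Integer using (+_)

  ratio-bound : ∀ (v m N h w : ℕ) (i : ℚ) → w ≡ 2 * suc h → N + m ≤ v → i ℚ.≤ + N ℚ./ suc h →
                + m ℚ./ 1 ℚ.≤ + v ℚ./ 1 ℚ.- (+ w ℚ./ 2) ℚ.* i
  ratio-bound v m N h .(2 * suc h) i refl N+m≤v i≤N/H =
    toℚᵘ-cancel-≤ (ℚᵘ.≤-respˡ-≃ (ℚᵘ.≃-sym (toℚᵘ-fromℚᵘ (nat m)))
                    (ℚᵘ.≤-respʳ-≃ (ℚᵘ.≃-sym rhs≃) (ℚᵘ.≤-trans m≤v-N v-N≤v-Hi)))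
    where
    nat : ℕ → ℚᵘ
    nat x = mkℚᵘ (+ x) 0
    H : ℚᵘ
    H = mkℚᵘ (+ (2 * suc h)) 1
    rhs≃ : toℚᵘ (+ v ℚ./ 1 ℚ.- (+ (2 * suc h) ℚ./ 2) ℚ.* i) ℚᵘ.≃ nat v ℚᵘ.- H ℚᵘ.* toℚᵘ i
    rhs≃ = ℚᵘ.≃-trans (toℚᵘ-homo-+ (+ v ℚ./ 1) (ℚ.- ((+ (2 * suc h) ℚ./ 2) ℚ.* i)))
             (ℚᵘ.+-cong (toℚᵘ-fromℚᵘ (nat v))
               (ℚᵘ.≃-trans (toℚᵘ-homo‿- ((+ (2 * suc h) ℚ./ 2) ℚ.* i))
                 (ℚᵘ.-‿cong (ℚᵘ.≃-trans (toℚᵘ-homo-* (+ (2 * suc h) ℚ./ 2) i) (ℚᵘ.*-congʳ (toℚᵘ-fromℚᵘ H))))))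
    Hi≤N : H ℚᵘ.* toℚᵘ i ℚᵘ.≤ nat N
    Hi≤N = ℚᵘ.≤-respʳ-≃ H·N/H≃N (ℚᵘ.*-monoʳ-≤-nonNeg H (ℚᵘ.≤-respʳ-≃ (toℚᵘ-fromℚᵘ (mkℚᵘ (+ N) h)) (toℚᵘ-mono-≤ i≤N/H)))
      where
      H·N/H≃N : H ℚᵘ.* mkℚᵘ (+ N) h ℚᵘ.≃ nat N
      H·N/H≃N = *≡* (trans (ℤ.*-identityʳ _) (ℤ.*-comm (+ (2 * suc h)) (+ N)))
    v-N≤v-Hi : nat v ℚᵘ.- nat N ℚᵘ.≤ nat v ℚᵘ.- H ℚᵘ.* toℚᵘ i
    v-N≤v-Hi = ℚᵘ.+-monoʳ-≤ (nat v) (ℚᵘ.neg-mono-≤ Hi≤N)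
    m≤v-N : nat m ℚᵘ.≤ nat v ℚᵘ.- nat N
    m≤v-N = *≤* (subst₂ ℤ._≤_ (sym (ℤ.*-identityʳ (+ m))) (sym (denominators-one (+ v) (+ N))) m≤v-N-in-ℤ)
      where
      denominators-one : ∀ V N′ → (V ℤ.* + 1 ℤ.+ ℤ.- N′ ℤ.* + 1) ℤ.* + 1 ≡ V ℤ.- N′
      denominators-one = ℤ-Solver.solve-∀
      add-sub : ∀ N′ M′ → N′ ℤ.+ M′ ℤ.- N′ ≡ M′
      add-sub = ℤ-Solver.solve-∀
      m≤v-N-in-ℤ : + m ℤ.≤ + v ℤ.- + N
      m≤v-N-in-ℤ = subst (ℤ._≤ + v ℤ.- + N) (add-sub (+ N) (+ m))
                     (ℤ.+-monoˡ-≤ (ℤ.- + N) (subst (ℤ._≤ + v) (ℤ.pos-+ N m) (ℤ.+≤+ N+m≤v)))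

open FloorOfC using (floor-condition)
open RatioBound using (ratio-bound)

-- H = n²(n² + 1)/2 is a triangular number.
triangle : ℕ → ℕ
triangle zero    = 0
triangle (suc q) = suc q + triangle q

double-triangle : ∀ q → 2 * triangle q ≡ q * (q + 1)
double-triangle zero    = refl
double-triangle (suc q) = begin
  2 * (suc q + triangle q)       ≡⟨ *-distribˡ-+ 2 (suc q) (triangle q) ⟩
  2 * suc q + 2 * triangle q     ≡⟨ cong (2 * suc q +_) (double-triangle q) ⟩
  2 * suc q + q * (q + 1)        ≡⟨ step q ⟩
  suc q * (suc q + 1)            ∎
  where
  open ≡-Reasoning
  step : ∀ q → 2 * (1 + q) + q * (q + 1) ≡ (1 + q) * ((1 + q) + 1)
  step = solve-∀

module UnitalNumbers (k : ℕ) where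
  open +-*-Solver

  lines-closed-form : ∀ b → b * suc (suc k) ≡ (suc k ^ 3 + 1) * suc k ^ 2 →
                      b ≡ suc k ^ 2 * (k * suc k + 1)
  lines-closed-form b eq = *-cancelʳ-≡ b _ (suc (suc k)) (trans eq (identity k))
    where
    identity : ∀ k → ((1 + k) ^ 3 + 1) * (1 + k) ^ 2 ≡ (1 + k) ^ 2 * (k * (1 + k) + 1) * (2 + k)
    identity = solve 1 (λ k → ((con 1 :+ k) :^ 3 :+ con 1) :* (con 1 :+ k) :^ 2
                          := (con 1 :+ k) :^ 2 :* (k :* (con 1 :+ k) :+ con 1) :* (con 2 :+ k)) refl

  vertex-total : suc k ^ 3 + 1 + suc k ^ 2 * (k * suc k + 1) ≡ suc k ^ 2 * (suc k ^ 2 + 1) + 1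
  vertex-total = solve 1 (λ k → (con 1 :+ k) :^ 3 :+ con 1 :+ (con 1 :+ k) :^ 2 :* (k :* (con 1 :+ k) :+ con 1)
                        := (con 1 :+ k) :^ 2 :* ((con 1 :+ k) :^ 2 :+ con 1) :+ con 1) refl k

  twice-lines : 2 * (suc k ^ 2 * (k * suc k + 1)) ≡ suc k ^ 2 * (suc k ^ 2 + 1) + suc k ^ 2 * (k * k)
  twice-lines = solve 1 (λ k → con 2 :* ((con 1 :+ k) :^ 2 :* (k :* (con 1 :+ k) :+ con 1))
                       := (con 1 :+ k) :^ 2 :* ((con 1 :+ k) :^ 2 :+ con 1) :+ (con 1 :+ k) :^ 2 :* (k :* k)) refl k

meeting-bound : ∀ M m q H → 2 * M + m * m ≡ 2 * (q * m) + m →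
                2 * q * m + 3 * m ≤ q * (q + 1) + m * m → 2 * H ≡ q * (q + 1) → M + m ≤ H
meeting-bound M m q H count small half = *-cancelˡ-≤ 2 (+-cancelʳ-≤ (m * m) (2 * (M + m)) (2 * H) (begin
  2 * (M + m) + m * m           ≡⟨ regroup M m ⟩
  2 * M + m * m + 2 * m         ≡⟨ cong (_+ 2 * m) count ⟩
  2 * (q * m) + m + 2 * m       ≡⟨ collect q m ⟩
  2 * q * m + 3 * m             ≤⟨ small ⟩
  q * (q + 1) + m * m           ≡⟨ cong (_+ m * m) half ⟨
  2 * H + m * m                 ∎))
  where
  open ≤-Reasoning
  regroup : ∀ M m → 2 * (M + m) + m * m ≡ 2 * M + m * m + 2 * m
  regroup = solve-∀
  collect : ∀ q m → 2 * (q * m) + m + 2 * m ≡ 2 * q * m + 3 * m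
  collect = solve-∀

half-pronic : ∀ q → 1 ≤ q → Σ ℕ λ h → 2 * suc h ≡ q * (q + 1)
half-pronic (suc j) _ = j + triangle j , double-triangle (suc j)

module IsoperimetricWitness (k : ℕ) (U : Unital (suc k)) (A : Subset (suc k ^ 3 + 1)) (arc : IsArc U A)
  (small : 2 * suc k ^ 2 * ∣ A ∣ + 3 * ∣ A ∣ ≤ suc k ^ 2 * (suc k ^ 2 + 1) + ∣ A ∣ * ∣ A ∣) where
  open Unital U
  open Counting U using (v; line-count)
  open Arc U A arc using (m; Meets; ∈-Meets; meets-count)
  open UnitalNumbers k
  open IncidenceGraph U using (nbhd-size)

  q : ℕ
  q = suc k ^ 2

  -- H = q(q + 1)/2, written as suc h.
  h : ℕ
  h = proj₁ (half-pronic q (m^n>0 (suc k) 2))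

  H : ℕ
  H = suc h

  half : 2 * H ≡ q * (q + 1)
  half = proj₂ (half-pronic q (m^n>0 (suc k) 2))

  H≤b : H ≤ b
  H≤b = *-cancelˡ-≤ 2 (begin
    2 * H                                  ≡⟨ half ⟩
    q * (q + 1)                            ≤⟨ m≤m+n (q * (q + 1)) (q * (k * k)) ⟩
    q * (q + 1) + q * (k * k)              ≡⟨ twice-lines ⟨
    2 * (q * (k * suc k + 1))              ≡⟨ cong (2 *_) (lines-closed-form b line-count) ⟨
    2 * b                                  ∎)
    where open ≤-Reasoning

  -- G_U has 2H + 1 vertices, so a set of H vertices is admissible in the definition of i(G_U).
  vertices : v + b ≡ 2 * H + 1
  vertices = begin
    v + b                                  ≡⟨ cong (v +_) (lines-closed-form b line-count) ⟩
    v + q * (k * suc k + 1)                ≡⟨ vertex-total ⟩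
    q * (q + 1) + 1                        ≡⟨ cong (_+ 1) half ⟨
    2 * H + 1                              ∎
    where open ≡-Reasoning

  M+m≤H : ∣ Meets ∣ + m ≤ H
  M+m≤H = meeting-bound ∣ Meets ∣ m q H meets-count small half

  half-vertices : 2 * H ≤ v + b
  half-vertices = subst (2 * H ≤_) (sym vertices) (m≤m+n (2 * H) 1)

  lines-chosen : Σ (Subset b) λ L → Meets ⊆ L × ∣ L ∣ ≡ H ∸ m
  lines-chosen = extend-to-size Meets (H ∸ m) (m+n≤o⇒m≤o∸n ∣ Meets ∣ M+m≤H) (≤-trans (m∸n≤m H m) H≤b)

  L : Subset b
  L = proj₁ lines-chosen

  S : Subset (v + b)
  S = A ++ L

  size-S : ∣ S ∣ ≡ H
  size-S = trans (size-++ A L) (trans (cong (m +_) (proj₂ (proj₂ lines-chosen)))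
                                      (m+[n∸m]≡n (≤-trans (m≤n+m m ∣ Meets ∣) M+m≤H)))

  nbhd-S : ∣ nbhd (incidenceGraph U) S ∣ + m ≤ v
  nbhd-S = nbhd-size A L (λ p∈A p∈j → proj₁ (proj₂ lines-chosen) (∈-Meets p∈A p∈j))

  -- Since i(G_U) ≤ |N(S)|/|S|, we get m ≤ v − H·i(G_U).
  iso-bound : (i : ℚ) → IsIsoNumber (incidenceGraph U) i →
              ℤ.+ m ℚ./ 1 ℚ.≤ ℤ.+ v ℚ./ 1 ℚ.- (ℤ.+ (q * (q + 1)) ℚ./ 2) ℚ.* i
  iso-bound i (_ , i-min) =
    ratio-bound v m ∣ nbhd (incidenceGraph U) S ∣ h (q * (q + 1)) i (sym half) nbhd-S (i-min S h size-S half-vertices)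

-- The theorem.  Either ⌊c(n)⌋ < m, or m ≤ ⌊c(n)⌋ and the arc bound applies.
corollary1p5 : ∀ (n : ℕ) → n ≥ 2 → (U : Unital n) →
    (m : ℕ) → IsMaxArcSize U m →
    (i : ℚ) → IsIsoNumber (incidenceGraph U) i →
    (fc : ℤ) → IsFloorC n fc →
    (fc ℤ.< ℤ.+ m) ⊎
    ((ℤ.+ m ℚ./ 1) ℚ.≤ (ℤ.+ (n ^ 3 + 1) ℚ./ 1) ℚ.- (ℤ.+ (n ^ 2 * (n ^ 2 + 1)) ℚ./ 2) ℚ.* i)
corollary1p5 zero ()
corollary1p5 (suc k) _ U .(∣ A ∣) ((A , arc , refl) , _) i iso fc floor =
  map₂ (λ fc≮m → IsoperimetricWitness.iso-bound k U A arc (small fc≮m) i iso) (toSum (fc ℤ.<? ℤ.+ ∣ A ∣))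
  where
  small : ¬ fc ℤ.< ℤ.+ ∣ A ∣ →
          2 * suc k ^ 2 * ∣ A ∣ + 3 * ∣ A ∣ ≤ suc k ^ 2 * (suc k ^ 2 + 1) + ∣ A ∣ * ∣ A ∣
  small fc≮m = floor-condition (suc k) ∣ A ∣ fc floor (ℤ.≮⇒≥ fc≮m)
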